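{- For all integers $n,j$ with $1\le j\le n$, $$\sum_{l=0}^{j-1}(-1)^{j-l-1}\binom{n-l-1}{n-j}\binom{n}{l}\frac{1}{(n-l)^3} = \frac{(H_n-H_{n-j})^3}{6}+\frac{(H_n-H_{n-j})(H_n^{(2)}-H_{n-j}^{(2)})}{2}+\frac{H_n^{(3)}-H_{n-j}^{(3)}}{3}.$$
   Context: $H_m^{(r)}=\sum_{i=1}^m i^{ -r}$, $H_m=H_m^{(1)}$, with $H_0^{(r)}=0$. -}

module Defs where

open import Data.Nat as ℕ using (ℕ; zero; suc)
open import Data.Nat.Combinatorics using (_C_)
open import Data.Integer as ℤ using (+_)
open import Data.Rational using (ℚ; 0ℚ; _/_; _+_; _*_; -_)

-- 1 / k^r as a rational; only ever applied with k ≥ 1 (value 0 at k = 0 is a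
-- junk convention that is never used by the statement).
invPow : ℕ → ℕ → ℚ
invPow zero    r = 0ℚ
invPow (suc k) zero    = (+ 1) / 1
invPow (suc k) (suc r) = ((+ 1) / suc k) * invPow (suc k) r

H : ℕ → ℕ → ℚ
H r zero    = 0ℚ
H r (suc m) = H r m + invPow (suc m) r

fromℕ : ℕ → ℚ
fromℕ k = (+ k) / 1

sgn : ℕ → ℚ
sgn zero    = (+ 1) / 1
sgn (suc k) = - sgn k

sumTo : ℕ → (ℕ → ℚ) → ℚ
sumTo zero    f = 0ℚ
sumTo (suc m) f = sumTo m f + f m

lhs : ℕ → ℕ → ℚ
lhs n j = sumTo j (λ l →
  sgn (j ℕ.∸ l ℕ.∸ 1) * fromℕ ((n ℕ.∸ l ℕ.∸ 1) C (n ℕ.∸ j))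
    * fromℕ (n C l) * invPow (n ℕ.∸ l) 3)

rhs : ℕ → ℕ → ℚ
rhs n j =
  let a = H 1 n Data.Rational.- H 1 (n ℕ.∸ j)
      b = H 2 n Data.Rational.- H 2 (n ℕ.∸ j)
      c = H 3 n Data.Rational.- H 3 (n ℕ.∸ j)
  in (a * a * a) * ((+ 1) / 6) + (a * b) * ((+ 1) / 2) + c * ((+ 1) / 3)

-- Put n = m + j and reverse the summation (i = j − 1 − l): the left-hand side becomes
-- S_r(N, p) = Σ_{i<p} (−1)^i C(m+i, m) C(N, m+i+1) / (m+i+1)^r at r = 3, N = m + j, p = j.
-- Pascal's rule in N, the absorption identity C(N, k)/(k+1) = C(N+1, k+1)/(N+1) and, for r = 0,
-- the vanishing of alternating binomial sums show that S_r(m+p, p) obeys the recursion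
--   h_{r+1}(p+1) = h_{r+1}(p) + x_p h_r(p+1),   h_0 = 1
-- of the complete homogeneous symmetric polynomials h_r(x_0, …, x_{p−1}) of x_i = 1/(m+i+1).
-- Newton's identity h_3 = p₁³/6 + p₁p₂/2 + p₃/3 in the power sums p_r = H^{(r)}_{m+p} − H^{(r)}_m
-- then gives the right-hand side.

module Submission where

open import Data.Nat as ℕ using (ℕ; zero; suc; _≤_; _<_)
import Data.Nat.Properties as ℕ
open import Data.Nat.Combinatorics using (_C_; nCk+nC[k+1]≡[n+1]C[k+1]; k>n⇒nCk≡0; nCk≡nC[n∸k]; nCn≡1)
open import Relation.Binary.PropositionalEquality
open import Defs

module _ where
  open import Data.Nat
  open import Data.Nat.Properties
  open import Data.Nat.Combinatorics
  open import Data.Nat.DivMod using (m/n*n≡m)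
  open import Data.Nat.Solver using (module +-*-Solver)
  open +-*-Solver
  open ≡-Reasoning

  [m+n]Cm*[m!*n!]≡[m+n]! : ∀ m n → ((m + n) C m) * (m ! * n !) ≡ (m + n) !
  [m+n]Cm*[m!*n!]≡[m+n]! m n = begin
    ((m + n) C m) * (m ! * n !)
      ≡⟨ cong (λ k → ((m + n) C m) * (m ! * k !)) (m+n∸m≡n m n) ⟨
    ((m + n) C m) * d
      ≡⟨ cong (_* d) (nCk≡n!/k![n-k]! (m≤m+n m n)) ⟩
    ((m + n) ! / d) {{d≢0}} * d
      ≡⟨ m/n*n≡m {{d≢0}} (k![n∸k]!∣n! (m≤m+n m n)) ⟩
    (m + n) ! ∎
    where
    d = m ! * (m + n ∸ m) !
    d≢0 = m !* (m + n ∸ m) !≢0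

  trinomial-revision : ∀ m i c →
    ((m + i) C m) * ((m + (i + c)) C (m + i)) ≡ ((m + (i + c)) C m) * ((i + c) C i)
  trinomial-revision m i c = *-cancelʳ-≡ _ _ (m ! * (i ! * c !)) {{m!*[i!*c!]≢0}} (begin
    X * Y * (m ! * (i ! * c !))
      ≡⟨ solve 5 (λ X Y a b c → X :* Y :* (a :* (b :* c)) := Y :* ((X :* (a :* b)) :* c)) refl X Y (m !) (i !) (c !) ⟩
    Y * ((X * (m ! * i !)) * c !)
      ≡⟨ cong (λ z → Y * (z * c !)) ([m+n]Cm*[m!*n!]≡[m+n]! m i) ⟩
    Y * ((m + i) ! * c !)
      ≡⟨ cong (λ z → (z C (m + i)) * ((m + i) ! * c !)) (+-assoc m i c) ⟨
    (((m + i) + c) C (m + i)) * ((m + i) ! * c !)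
      ≡⟨ [m+n]Cm*[m!*n!]≡[m+n]! (m + i) c ⟩
    ((m + i) + c) !
      ≡⟨ cong _! (+-assoc m i c) ⟩
    (m + (i + c)) !
      ≡⟨ [m+n]Cm*[m!*n!]≡[m+n]! m (i + c) ⟨
    Z * (m ! * (i + c) !)
      ≡⟨ cong (λ z → Z * (m ! * z)) ([m+n]Cm*[m!*n!]≡[m+n]! i c) ⟨
    Z * (m ! * (W * (i ! * c !)))
      ≡⟨ solve 5 (λ Z W a b c → Z :* (a :* (W :* (b :* c))) := Z :* W :* (a :* (b :* c))) refl Z W (m !) (i !) (c !) ⟩
    Z * W * (m ! * (i ! * c !)) ∎)
    where
    X = (m + i) C m
    Y = (m + (i + c)) C (m + i)
    Z = (m + (i + c)) C m
    W = (i + c) C i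
    m!*[i!*c!]≢0 = m*n≢0 (m !) (i ! * c !) {{m !≢0}} {{m*n≢0 (i !) (c !) {{i !≢0}} {{c !≢0}}}}

  [1+k]*[1+n]C[1+k]≡[1+n]*nCk : ∀ n k → suc k * (suc n C suc k) ≡ suc n * (n C k)
  [1+k]*[1+n]C[1+k]≡[1+n]*nCk zero    zero    = refl
  [1+k]*[1+n]C[1+k]≡[1+n]*nCk zero    (suc k) = trans (cong (suc (suc k) *_) (k>n⇒nCk≡0 {1} {suc (suc k)} (s<s z<s))) (*-zeroʳ (suc (suc k)))
  [1+k]*[1+n]C[1+k]≡[1+n]*nCk (suc n) zero    = trans (+-identityʳ _) (trans (nC1≡n (suc (suc n))) (sym (*-identityʳ (suc (suc n)))))
  [1+k]*[1+n]C[1+k]≡[1+n]*nCk (suc n) (suc k) = begin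
    suc (suc k) * (suc (suc n) C suc (suc k))
      ≡⟨ cong (suc (suc k) *_) (nCk+nC[k+1]≡[n+1]C[k+1] (suc n) (suc k)) ⟨
    suc (suc k) * (a + b)
      ≡⟨ solve 3 (λ k a b → (con 1 :+ k) :* (a :+ b) := k :* a :+ a :+ (con 1 :+ k) :* b) refl (suc k) a b ⟩
    suc k * a + a + suc (suc k) * b
      ≡⟨ cong₂ (λ u v → u + a + v) ([1+k]*[1+n]C[1+k]≡[1+n]*nCk n k) ([1+k]*[1+n]C[1+k]≡[1+n]*nCk n (suc k)) ⟩
    suc n * (n C k) + a + suc n * (n C suc k)
      ≡⟨ solve 4 (λ n u v a → n :* u :+ a :+ n :* v := n :* (u :+ v) :+ a) refl (suc n) (n C k) (n C suc k) a ⟩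
    suc n * (n C k + n C suc k) + a
      ≡⟨ cong (λ z → suc n * z + a) (nCk+nC[k+1]≡[n+1]C[k+1] n k) ⟩
    suc n * a + a
      ≡⟨ +-comm (suc n * a) a ⟩
    suc (suc n) * a ∎
    where
    a = suc n C suc k
    b = suc n C suc (suc k)

import Data.Integer as ℤ
open import Data.Rational using (ℚ; 0ℚ; 1ℚ; _+_; _*_; _-_; _/_; fromℚᵘ)
open import Data.Rational.Properties
import Data.Rational.Unnormalised as ℚᵘ
import Data.Rational.Unnormalised.Properties as ℚᵘ
open import Algebra.Definitions.RawSemiring +-*-rawSemiring using (_^_)
open import Algebra.Bundles using (CommutativeRing)
open import Algebra.Properties.Semiring.Mult (CommutativeRing.semiring +-*-commutativeRing) using (_×_; ×-homo-+; ×1-homo-*)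

fromℚᵘ-homo-+ : ∀ p q → fromℚᵘ (p ℚᵘ.+ q) ≡ fromℚᵘ p + fromℚᵘ q
fromℚᵘ-homo-+ p q = toℚᵘ-injective (ℚᵘ.≃-trans (toℚᵘ-fromℚᵘ (p ℚᵘ.+ q))
  (ℚᵘ.≃-sym (ℚᵘ.≃-trans (toℚᵘ-homo-+ (fromℚᵘ p) (fromℚᵘ q)) (ℚᵘ.+-cong (toℚᵘ-fromℚᵘ p) (toℚᵘ-fromℚᵘ q)))))

fromℚᵘ-homo-* : ∀ p q → fromℚᵘ (p ℚᵘ.* q) ≡ fromℚᵘ p * fromℚᵘ q
fromℚᵘ-homo-* p q = toℚᵘ-injective (ℚᵘ.≃-trans (toℚᵘ-fromℚᵘ (p ℚᵘ.* q))
  (ℚᵘ.≃-sym (ℚᵘ.≃-trans (toℚᵘ-homo-* (fromℚᵘ p) (fromℚᵘ q)) (ℚᵘ.*-cong (toℚᵘ-fromℚᵘ p) (toℚᵘ-fromℚᵘ q)))))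

fromℕ-suc : ∀ k → fromℕ (suc k) ≡ 1ℚ + fromℕ k
fromℕ-suc k = trans (fromℚᵘ-cong [1+k]≃1+k) (fromℚᵘ-homo-+ ℚᵘ.1ℚᵘ k/1)
  where
  open import Data.Integer.Solver using (module +-*-Solver)
  open +-*-Solver
  k/1 = ℚᵘ.mkℚᵘ (ℤ.+ k) 0
  [1+k]≃1+k : ℚᵘ.mkℚᵘ (ℤ.+ suc k) 0 ℚᵘ.≃ ℚᵘ.1ℚᵘ ℚᵘ.+ k/1
  [1+k]≃1+k = ℚᵘ.*≡* (solve 1 (λ k → (con ℤ.1ℤ :+ k) :* con ℤ.1ℤ := (con ℤ.1ℤ :* con ℤ.1ℤ :+ k :* con ℤ.1ℤ) :* con ℤ.1ℤ) refl (ℤ.+ k))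

1/suc : ℕ → ℚ
1/suc k = (ℤ.+ 1) / suc k

1/suc-inverseˡ : ∀ k → 1/suc k * fromℕ (suc k) ≡ 1ℚ
1/suc-inverseˡ k = trans (sym (fromℚᵘ-homo-* 1/[1+k] [1+k]/1)) (fromℚᵘ-cong 1/[1+k]*[1+k]≃1)
  where
  open import Data.Integer.Solver using (module +-*-Solver)
  open +-*-Solver
  1/[1+k] = ℚᵘ.mkℚᵘ (ℤ.+ 1) k
  [1+k]/1 = ℚᵘ.mkℚᵘ (ℤ.+ suc k) 0
  1/[1+k]*[1+k]≃1 : 1/[1+k] ℚᵘ.* [1+k]/1 ℚᵘ.≃ ℚᵘ.1ℚᵘ
  1/[1+k]*[1+k]≃1 = ℚᵘ.*≡* (solve 1 (λ k → (con ℤ.1ℤ :* k) :* con ℤ.1ℤ := con ℤ.1ℤ :* (k :* con ℤ.1ℤ)) refl (ℤ.+ suc k))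

open import Data.Rational.Solver using (module +-*-Solver)
open +-*-Solver

fromℕ≡×1 : ∀ k → fromℕ k ≡ k × 1ℚ
fromℕ≡×1 zero    = refl
fromℕ≡×1 (suc k) = trans (fromℕ-suc k) (cong (_+_ 1ℚ) (fromℕ≡×1 k))

fromℕ-homo-+ : ∀ a b → fromℕ (a ℕ.+ b) ≡ fromℕ a + fromℕ b
fromℕ-homo-+ a b = trans (fromℕ≡×1 (a ℕ.+ b)) (trans (×-homo-+ 1ℚ a b) (sym (cong₂ _+_ (fromℕ≡×1 a) (fromℕ≡×1 b))))

fromℕ-homo-* : ∀ a b → fromℕ (a ℕ.* b) ≡ fromℕ a * fromℕ b
fromℕ-homo-* a b = trans (fromℕ≡×1 (a ℕ.* b)) (trans (×1-homo-* a b) (sym (cong₂ _*_ (fromℕ≡×1 a) (fromℕ≡×1 b))))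

sumTo-cong : ∀ n {f g : ℕ → ℚ} → (∀ i → i < n → f i ≡ g i) → sumTo n f ≡ sumTo n g
sumTo-cong zero    f≗g = refl
sumTo-cong (suc n) f≗g = cong₂ _+_ (sumTo-cong n (λ i i<n → f≗g i (ℕ.m<n⇒m<1+n i<n))) (f≗g n (ℕ.n<1+n n))

sumTo-distrib-+ : ∀ n (f g : ℕ → ℚ) → sumTo n (λ i → f i + g i) ≡ sumTo n f + sumTo n g
sumTo-distrib-+ zero    f g = refl
sumTo-distrib-+ (suc n) f g = trans (cong (_+ (f n + g n)) (sumTo-distrib-+ n f g))
  (solve 4 (λ a b c d → (a :+ b) :+ (c :+ d) := (a :+ c) :+ (b :+ d)) refl (sumTo n f) (sumTo n g) (f n) (g n))

*-distribˡ-sumTo : ∀ n a (f : ℕ → ℚ) → a * sumTo n f ≡ sumTo n (λ i → a * f i)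
*-distribˡ-sumTo zero    a f = *-zeroʳ a
*-distribˡ-sumTo (suc n) a f = trans (*-distribˡ-+ a (sumTo n f) (f n)) (cong (_+ a * f n) (*-distribˡ-sumTo n a f))

sumTo-suc : ∀ n (f : ℕ → ℚ) → sumTo (suc n) f ≡ f 0 + sumTo n (λ i → f (suc i))
sumTo-suc zero    f = trans (+-identityˡ (f 0)) (sym (+-identityʳ (f 0)))
sumTo-suc (suc n) f = trans (cong (_+ f (suc n)) (sumTo-suc n f)) (+-assoc (f 0) _ _)

sumTo-reverse : ∀ n (f : ℕ → ℚ) → sumTo n f ≡ sumTo n (λ i → f (n ℕ.∸ suc i))
sumTo-reverse zero    f = refl
sumTo-reverse (suc n) f = trans (+-comm (sumTo n f) (f n))
  (trans (cong (f n +_) (sumTo-reverse n f)) (sym (sumTo-suc n (λ i → f (n ℕ.∸ i)))))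

powerSum : (ℕ → ℚ) → ℕ → ℕ → ℚ
powerSum x r p = sumTo p (λ i → x i ^ r)

h : (ℕ → ℚ) → ℕ → ℕ → ℚ
h x zero    p       = 1ℚ
h x (suc r) zero    = 0ℚ
h x (suc r) (suc p) = h x (suc r) p + x p * h x r (suc p)

newton₃ : ℚ → ℚ → ℚ → ℚ
newton₃ a b c = (a * a * a) * (ℤ.+ 1 / 6) + (a * b) * (ℤ.+ 1 / 2) + c * (ℤ.+ 1 / 3)

newton₃-cong : ∀ {a a′ b b′ c c′} → a ≡ a′ → b ≡ b′ → c ≡ c′ → newton₃ a b c ≡ newton₃ a′ b′ c′
newton₃-cong refl refl refl = refl

module _ (x : ℕ → ℚ) where

  h₁-newton : ∀ p → h x 1 p ≡ powerSum x 1 p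
  h₁-newton zero    = refl
  h₁-newton (suc p) = cong (_+ x p * 1ℚ) (h₁-newton p)

  h₂-newton : ∀ p → h x 2 p ≡ (powerSum x 1 p * powerSum x 1 p + powerSum x 2 p) * (ℤ.+ 1 / 2)
  h₂-newton zero    = refl
  h₂-newton (suc p) = trans (cong₂ (λ u v → u + x p * v) (h₂-newton p) (h₁-newton (suc p)))
    (solve 3 (λ a b y → (a :* a :+ b) :* con (ℤ.+ 1 / 2) :+ y :* (a :+ y :^ 1)
                     := ((a :+ y :^ 1) :* (a :+ y :^ 1) :+ (b :+ y :^ 2)) :* con (ℤ.+ 1 / 2))
           refl (powerSum x 1 p) (powerSum x 2 p) (x p))

  h₃-newton : ∀ p → h x 3 p ≡ newton₃ (powerSum x 1 p) (powerSum x 2 p) (powerSum x 3 p)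
  h₃-newton zero    = refl
  h₃-newton (suc p) = trans (cong₂ (λ u v → u + x p * v) (h₃-newton p) (h₂-newton (suc p)))
    (solve 4 (λ a b c y →
         (a :* a :* a) :* con (ℤ.+ 1 / 6) :+ (a :* b) :* con (ℤ.+ 1 / 2) :+ c :* con (ℤ.+ 1 / 3)
           :+ y :* (((a :+ y :^ 1) :* (a :+ y :^ 1) :+ (b :+ y :^ 2)) :* con (ℤ.+ 1 / 2))
      := ((a :+ y :^ 1) :* (a :+ y :^ 1) :* (a :+ y :^ 1)) :* con (ℤ.+ 1 / 6)
           :+ ((a :+ y :^ 1) :* (b :+ y :^ 2)) :* con (ℤ.+ 1 / 2) :+ (c :+ y :^ 3) :* con (ℤ.+ 1 / 3))
      refl (powerSum x 1 p) (powerSum x 2 p) (powerSum x 3 p) (x p))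

fromℕ-*-≡ : ∀ {a b c d} → a ℕ.* b ≡ c ℕ.* d → fromℕ a * fromℕ b ≡ fromℕ c * fromℕ d
fromℕ-*-≡ {a} {b} {c} {d} eq = trans (sym (fromℕ-homo-* a b)) (trans (cong fromℕ eq) (fromℕ-homo-* c d))

cross-multiply : ∀ n k {a b} → fromℕ (suc n) * a ≡ fromℕ (suc k) * b → a * 1/suc k ≡ 1/suc n * b
cross-multiply n k {a} {b} eq = begin
  a * 1/suc k                                   ≡⟨ *-identityʳ _ ⟨
  a * 1/suc k * 1ℚ                              ≡⟨ cong (a * 1/suc k *_) (1/suc-inverseˡ n) ⟨
  a * 1/suc k * (1/suc n * fromℕ (suc n))       ≡⟨ solve 4 (λ a u v s → a :* u :* (v :* s) := u :* v :* (s :* a)) refl a (1/suc k) (1/suc n) (fromℕ (suc n)) ⟩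
  1/suc k * 1/suc n * (fromℕ (suc n) * a)       ≡⟨ cong (1/suc k * 1/suc n *_) eq ⟩
  1/suc k * 1/suc n * (fromℕ (suc k) * b)       ≡⟨ solve 4 (λ u v s b → u :* v :* (s :* b) := v :* b :* (u :* s)) refl (1/suc k) (1/suc n) (fromℕ (suc k)) b ⟩
  1/suc n * b * (1/suc k * fromℕ (suc k))       ≡⟨ cong (1/suc n * b *_) (1/suc-inverseˡ k) ⟩
  1/suc n * b * 1ℚ                              ≡⟨ *-identityʳ _ ⟩
  1/suc n * b                                   ∎
  where open ≡-Reasoning

alternatingSum-partial : ∀ p q → sumTo (suc q) (λ i → sgn i * fromℕ (suc p C i)) ≡ sgn q * fromℕ (p C q)
alternatingSum-partial p zero    = refl
alternatingSum-partial p (suc q) = begin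
  sumTo (suc q) f + sgn (suc q) * fromℕ (suc p C suc q)
    ≡⟨ cong₂ (λ u c → u + sgn (suc q) * fromℕ c) (alternatingSum-partial p q) (sym (nCk+nC[k+1]≡[n+1]C[k+1] p q)) ⟩
  sgn q * fromℕ (p C q) + sgn (suc q) * fromℕ (p C q ℕ.+ p C suc q)
    ≡⟨ cong (λ c → sgn q * fromℕ (p C q) + sgn (suc q) * c) (fromℕ-homo-+ (p C q) (p C suc q)) ⟩
  sgn q * fromℕ (p C q) + sgn (suc q) * (fromℕ (p C q) + fromℕ (p C suc q))
    ≡⟨ solve 3 (λ s a b → s :* a :+ (:- s) :* (a :+ b) := (:- s) :* b) refl (sgn q) (fromℕ (p C q)) (fromℕ (p C suc q)) ⟩
  sgn (suc q) * fromℕ (p C suc q) ∎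
  where
  open ≡-Reasoning
  f = λ i → sgn i * fromℕ (suc p C i)

alternatingSum-vanishes : ∀ p → sumTo (suc (suc p)) (λ i → sgn i * fromℕ (suc p C i)) ≡ 0ℚ
alternatingSum-vanishes p = trans (alternatingSum-partial p (suc p))
  (trans (cong (λ c → sgn (suc p) * fromℕ c) (k>n⇒nCk≡0 (ℕ.n<1+n p))) (*-zeroʳ (sgn (suc p))))

weight : ℕ → ℕ → ℕ → ℚ
weight m r i = sgn i * fromℕ ((m ℕ.+ i) C m) * invPow (suc (m ℕ.+ i)) r

binomialSum : ℕ → ℕ → ℕ → ℕ → ℚ
binomialSum m r N p = sumTo p (λ i → weight m r i * fromℕ (N C suc (m ℕ.+ i)))

binomialSum⁻ : ℕ → ℕ → ℕ → ℕ → ℚ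
binomialSum⁻ m r N p = sumTo p (λ i → weight m r i * fromℕ (N C (m ℕ.+ i)))

module _ (m : ℕ) where

  binomialSum-pascal : ∀ r N p → binomialSum m r (suc N) p ≡ binomialSum⁻ m r N p + binomialSum m r N p
  binomialSum-pascal r N p = trans (sumTo-cong p (λ i _ → pascal i)) (sumTo-distrib-+ p _ _)
    where
    pascal : ∀ i → weight m r i * fromℕ (suc N C suc (m ℕ.+ i)) ≡
      weight m r i * fromℕ (N C (m ℕ.+ i)) + weight m r i * fromℕ (N C suc (m ℕ.+ i))
    pascal i = trans (cong (λ c → weight m r i * fromℕ c) (sym (nCk+nC[k+1]≡[n+1]C[k+1] N (m ℕ.+ i))))
      (trans (cong (weight m r i *_) (fromℕ-homo-+ (N C (m ℕ.+ i)) (N C suc (m ℕ.+ i)))) (*-distribˡ-+ (weight m r i) _ _))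

  binomialSum-suc : ∀ r p → binomialSum m r (m ℕ.+ suc p) (suc p) ≡
    binomialSum⁻ m r (m ℕ.+ p) (suc p) + binomialSum m r (m ℕ.+ p) p
  binomialSum-suc r p = begin
    binomialSum m r (m ℕ.+ suc p) (suc p)    ≡⟨ cong (λ N → binomialSum m r N (suc p)) (ℕ.+-suc m p) ⟩
    binomialSum m r (suc (m ℕ.+ p)) (suc p)  ≡⟨ binomialSum-pascal r (m ℕ.+ p) (suc p) ⟩
    S⁻ + (S + lastTerm)                       ≡⟨ cong (λ t → S⁻ + (S + t)) lastTerm≡0 ⟩
    S⁻ + (S + 0ℚ)                             ≡⟨ cong (S⁻ +_) (+-identityʳ S) ⟩
    S⁻ + S                                    ∎
    where
    open ≡-Reasoning
    S⁻ = binomialSum⁻ m r (m ℕ.+ p) (suc p)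
    S = binomialSum m r (m ℕ.+ p) p
    lastTerm = weight m r p * fromℕ ((m ℕ.+ p) C suc (m ℕ.+ p))
    lastTerm≡0 : lastTerm ≡ 0ℚ
    lastTerm≡0 = trans (cong (λ c → weight m r p * fromℕ c) (k>n⇒nCk≡0 (ℕ.n<1+n (m ℕ.+ p)))) (*-zeroʳ (weight m r p))

  binomialSum⁻-absorption : ∀ r N p → binomialSum⁻ m (suc r) N p ≡ 1/suc N * binomialSum m r (suc N) p
  binomialSum⁻-absorption r N p = trans (sumTo-cong p (λ i _ → absorb i)) (sym (*-distribˡ-sumTo p (1/suc N) _))
    where
    absorb : ∀ i → weight m (suc r) i * fromℕ (N C (m ℕ.+ i)) ≡ 1/suc N * (weight m r i * fromℕ (suc N C suc (m ℕ.+ i)))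
    absorb i = begin
      s * c * (1/suc K * v) * fromℕ (N C K)
        ≡⟨ solve 5 (λ s c u v a → s :* c :* (u :* v) :* a := s :* c :* v :* (a :* u)) refl s c (1/suc K) v (fromℕ (N C K)) ⟩
      s * c * v * (fromℕ (N C K) * 1/suc K)
        ≡⟨ cong (s * c * v *_) (cross-multiply N K (fromℕ-*-≡ {suc N} {N C K} {suc K} {suc N C suc K} (sym ([1+k]*[1+n]C[1+k]≡[1+n]*nCk N K)))) ⟩
      s * c * v * (1/suc N * fromℕ (suc N C suc K))
        ≡⟨ solve 5 (λ s c v u a → s :* c :* v :* (u :* a) := u :* (s :* c :* v :* a)) refl s c v (1/suc N) (fromℕ (suc N C suc K)) ⟩
      1/suc N * (s * c * v * fromℕ (suc N C suc K)) ∎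
      where
      open ≡-Reasoning
      K = m ℕ.+ i
      s = sgn i
      c = fromℕ (K C m)
      v = invPow (suc K) r

  binomialSum⁻₀ : ∀ p → binomialSum⁻ m 0 (m ℕ.+ p) (suc p) ≡
    fromℕ ((m ℕ.+ p) C m) * sumTo (suc p) (λ i → sgn i * fromℕ (p C i))
  binomialSum⁻₀ p = trans (sumTo-cong (suc p) term) (sym (*-distribˡ-sumTo (suc p) (fromℕ ((m ℕ.+ p) C m)) (λ i → sgn i * fromℕ (p C i))))
    where
    term-split : ∀ i d → weight m 0 i * fromℕ ((m ℕ.+ (i ℕ.+ d)) C (m ℕ.+ i)) ≡
      fromℕ ((m ℕ.+ (i ℕ.+ d)) C m) * (sgn i * fromℕ ((i ℕ.+ d) C i))
    term-split i d = begin
      sgn i * fromℕ X * 1ℚ * fromℕ Y   ≡⟨ solve 3 (λ s a b → s :* a :* con 1ℚ :* b := s :* (a :* b)) refl (sgn i) (fromℕ X) (fromℕ Y) ⟩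
      sgn i * (fromℕ X * fromℕ Y)      ≡⟨ cong (sgn i *_) (fromℕ-*-≡ {X} {Y} {Z} {W} (trinomial-revision m i d)) ⟩
      sgn i * (fromℕ Z * fromℕ W)      ≡⟨ solve 3 (λ s a b → s :* (a :* b) := a :* (s :* b)) refl (sgn i) (fromℕ Z) (fromℕ W) ⟩
      fromℕ Z * (sgn i * fromℕ W)      ∎
      where
      open ≡-Reasoning
      X = (m ℕ.+ i) C m
      Y = (m ℕ.+ (i ℕ.+ d)) C (m ℕ.+ i)
      Z = (m ℕ.+ (i ℕ.+ d)) C m
      W = (i ℕ.+ d) C i
    term : ∀ i → i < suc p → weight m 0 i * fromℕ ((m ℕ.+ p) C (m ℕ.+ i)) ≡ fromℕ ((m ℕ.+ p) C m) * (sgn i * fromℕ (p C i))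
    term i i<1+p = subst (λ p → weight m 0 i * fromℕ ((m ℕ.+ p) C (m ℕ.+ i)) ≡ fromℕ ((m ℕ.+ p) C m) * (sgn i * fromℕ (p C i)))
      (ℕ.m+[n∸m]≡n (ℕ.≤-pred i<1+p)) (term-split i (p ℕ.∸ i))

  binomialSum₀ : ∀ p → binomialSum m 0 (m ℕ.+ suc p) (suc p) ≡ 1ℚ
  binomialSum₀ zero = begin
    binomialSum m 0 (m ℕ.+ 1) 1                   ≡⟨ binomialSum-suc 0 0 ⟩
    binomialSum⁻ m 0 (m ℕ.+ 0) 1 + 0ℚ             ≡⟨ +-identityʳ _ ⟩
    binomialSum⁻ m 0 (m ℕ.+ 0) 1                  ≡⟨ binomialSum⁻₀ 0 ⟩
    fromℕ ((m ℕ.+ 0) C m) * 1ℚ                    ≡⟨ cong (λ k → fromℕ (k C m) * 1ℚ) (ℕ.+-identityʳ m) ⟩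
    fromℕ (m C m) * 1ℚ                            ≡⟨ cong (λ c → fromℕ c * 1ℚ) (nCn≡1 m) ⟩
    1ℚ                                            ∎
    where open ≡-Reasoning
  binomialSum₀ (suc p) = begin
    binomialSum m 0 (m ℕ.+ suc (suc p)) (suc (suc p))
      ≡⟨ binomialSum-suc 0 (suc p) ⟩
    binomialSum⁻ m 0 (m ℕ.+ suc p) (suc (suc p)) + binomialSum m 0 (m ℕ.+ suc p) (suc p)
      ≡⟨ cong₂ _+_ (binomialSum⁻₀ (suc p)) (binomialSum₀ p) ⟩
    c * sumTo (suc (suc p)) (λ i → sgn i * fromℕ (suc p C i)) + 1ℚ
      ≡⟨ cong (λ a → c * a + 1ℚ) (alternatingSum-vanishes p) ⟩
    c * 0ℚ + 1ℚ
      ≡⟨ cong (_+ 1ℚ) (*-zeroʳ c) ⟩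
    1ℚ ∎
    where
    open ≡-Reasoning
    c = fromℕ ((m ℕ.+ suc p) C m)

  binomialSum-step : ∀ r p → binomialSum m (suc r) (m ℕ.+ suc p) (suc p) ≡
    binomialSum m (suc r) (m ℕ.+ p) p + 1/suc (m ℕ.+ p) * binomialSum m r (m ℕ.+ suc p) (suc p)
  binomialSum-step r p = begin
    binomialSum m (suc r) (m ℕ.+ suc p) (suc p)
      ≡⟨ binomialSum-suc (suc r) p ⟩
    binomialSum⁻ m (suc r) (m ℕ.+ p) (suc p) + S
      ≡⟨ +-comm (binomialSum⁻ m (suc r) (m ℕ.+ p) (suc p)) S ⟩
    S + binomialSum⁻ m (suc r) (m ℕ.+ p) (suc p)
      ≡⟨ cong (S +_) (binomialSum⁻-absorption r (m ℕ.+ p) (suc p)) ⟩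
    S + 1/suc (m ℕ.+ p) * binomialSum m r (suc (m ℕ.+ p)) (suc p)
      ≡⟨ cong (λ N → S + 1/suc (m ℕ.+ p) * binomialSum m r N (suc p)) (ℕ.+-suc m p) ⟨
    S + 1/suc (m ℕ.+ p) * binomialSum m r (m ℕ.+ suc p) (suc p) ∎
    where
    open ≡-Reasoning
    S = binomialSum m (suc r) (m ℕ.+ p) p

  binomialSum≡h : ∀ r p → binomialSum m (suc r) (m ℕ.+ p) p ≡ h (λ i → 1/suc (m ℕ.+ i)) (suc r) p
  binomialSum≡h r       zero    = refl
  binomialSum≡h zero    (suc p) = trans (binomialSum-step 0 p)
    (cong₂ (λ a b → a + 1/suc (m ℕ.+ p) * b) (binomialSum≡h 0 p) (binomialSum₀ p))
  binomialSum≡h (suc r) (suc p) = trans (binomialSum-step (suc r) p)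
    (cong₂ (λ a b → a + 1/suc (m ℕ.+ p) * b) (binomialSum≡h (suc r) p) (binomialSum≡h r (suc p)))

invPow≡1/suc^ : ∀ k r → invPow (suc k) r ≡ 1/suc k ^ r
invPow≡1/suc^ k zero    = refl
invPow≡1/suc^ k (suc r) = cong (1/suc k *_) (invPow≡1/suc^ k r)

H-difference : ∀ r m p → H r (m ℕ.+ p) - H r m ≡ powerSum (λ i → 1/suc (m ℕ.+ i)) r p
H-difference r m zero    rewrite ℕ.+-identityʳ m = +-inverseʳ (H r m)
H-difference r m (suc p) rewrite ℕ.+-suc m p = begin
  (H r (m ℕ.+ p) + invPow (suc (m ℕ.+ p)) r) - H r m
    ≡⟨ solve 3 (λ a v b → (a :+ v) :- b := (a :- b) :+ v) refl (H r (m ℕ.+ p)) (invPow (suc (m ℕ.+ p)) r) (H r m) ⟩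
  (H r (m ℕ.+ p) - H r m) + invPow (suc (m ℕ.+ p)) r
    ≡⟨ cong₂ _+_ (H-difference r m p) (invPow≡1/suc^ (m ℕ.+ p) r) ⟩
  powerSum (λ i → 1/suc (m ℕ.+ i)) r (suc p) ∎
  where open ≡-Reasoning

rhs≡h₃ : ∀ m j → rhs (m ℕ.+ j) j ≡ h (λ i → 1/suc (m ℕ.+ i)) 3 j
rhs≡h₃ m j = begin
  rhs (m ℕ.+ j) j
    ≡⟨ cong (λ k → newton₃ (H 1 (m ℕ.+ j) - H 1 k) (H 2 (m ℕ.+ j) - H 2 k) (H 3 (m ℕ.+ j) - H 3 k)) (ℕ.m+n∸n≡m m j) ⟩
  newton₃ (H 1 (m ℕ.+ j) - H 1 m) (H 2 (m ℕ.+ j) - H 2 m) (H 3 (m ℕ.+ j) - H 3 m)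
    ≡⟨ newton₃-cong (H-difference 1 m j) (H-difference 2 m j) (H-difference 3 m j) ⟩
  newton₃ (powerSum x 1 j) (powerSum x 2 j) (powerSum x 3 j)
    ≡⟨ h₃-newton x j ⟨
  h x 3 j ∎
  where
  open ≡-Reasoning
  x = λ i → 1/suc (m ℕ.+ i)

lhsTerm : ℕ → ℕ → ℕ → ℚ
lhsTerm n j l = sgn (j ℕ.∸ l ℕ.∸ 1) * fromℕ ((n ℕ.∸ l ℕ.∸ 1) C (n ℕ.∸ j)) * fromℕ (n C l) * invPow (n ℕ.∸ l) 3

lhsTerm-reindex : ∀ m i d → let j = suc i ℕ.+ d in
  lhsTerm (m ℕ.+ j) j (j ℕ.∸ suc i) ≡ weight m 3 i * fromℕ ((m ℕ.+ j) C suc (m ℕ.+ i))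
lhsTerm-reindex m i d = begin
  lhsTerm n j (j ℕ.∸ suc i)
    ≡⟨ cong (lhsTerm n j) (ℕ.m+n∸m≡n (suc i) d) ⟩
  sgn (j ℕ.∸ d ℕ.∸ 1) * fromℕ ((n ℕ.∸ d ℕ.∸ 1) C (n ℕ.∸ j)) * fromℕ (n C d) * invPow (n ℕ.∸ d) 3
    ≡⟨ cong₂ (λ a b → sgn a * fromℕ ((n ℕ.∸ d ℕ.∸ 1) C b) * fromℕ (n C d) * invPow (n ℕ.∸ d) 3) (cong (ℕ._∸ 1) (ℕ.m+n∸n≡m (suc i) d)) (ℕ.m+n∸n≡m m j) ⟩
  sgn i * fromℕ ((n ℕ.∸ d ℕ.∸ 1) C m) * fromℕ (n C d) * invPow (n ℕ.∸ d) 3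
    ≡⟨ cong (λ c → sgn i * fromℕ ((n ℕ.∸ d ℕ.∸ 1) C m) * fromℕ c * invPow (n ℕ.∸ d) 3) (nCk≡nC[n∸k] d≤n) ⟩
  sgn i * fromℕ ((n ℕ.∸ d ℕ.∸ 1) C m) * fromℕ (n C (n ℕ.∸ d)) * invPow (n ℕ.∸ d) 3
    ≡⟨ cong (λ k → sgn i * fromℕ ((k ℕ.∸ 1) C m) * fromℕ (n C k) * invPow k 3) n∸d≡1+m+i ⟩
  sgn i * fromℕ ((m ℕ.+ i) C m) * fromℕ (n C suc (m ℕ.+ i)) * invPow (suc (m ℕ.+ i)) 3
    ≡⟨ solve 4 (λ s a b c → s :* a :* b :* c := s :* a :* c :* b) refl
         (sgn i) (fromℕ ((m ℕ.+ i) C m)) (fromℕ (n C suc (m ℕ.+ i))) (invPow (suc (m ℕ.+ i)) 3) ⟩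
  weight m 3 i * fromℕ (n C suc (m ℕ.+ i)) ∎
  where
  open ≡-Reasoning
  j = suc i ℕ.+ d
  n = m ℕ.+ j
  d≤n : d ≤ n
  d≤n = ℕ.≤-trans (ℕ.m≤n+m d (suc i)) (ℕ.m≤n+m j m)
  n∸d≡1+m+i : n ℕ.∸ d ≡ suc (m ℕ.+ i)
  n∸d≡1+m+i = trans (cong (ℕ._∸ d) (sym (ℕ.+-assoc m (suc i) d))) (trans (ℕ.m+n∸n≡m (m ℕ.+ suc i) d) (ℕ.+-suc m i))

lhs≡binomialSum : ∀ m j → lhs (m ℕ.+ j) j ≡ binomialSum m 3 (m ℕ.+ j) j
lhs≡binomialSum m j = trans (sumTo-reverse j (lhsTerm (m ℕ.+ j) j)) (sumTo-cong j term)
  where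
  term : ∀ i → i < j → lhsTerm (m ℕ.+ j) j (j ℕ.∸ suc i) ≡ weight m 3 i * fromℕ ((m ℕ.+ j) C suc (m ℕ.+ i))
  term i i<j = subst (λ j → lhsTerm (m ℕ.+ j) j (j ℕ.∸ suc i) ≡ weight m 3 i * fromℕ ((m ℕ.+ j) C suc (m ℕ.+ i)))
    (ℕ.m+[n∸m]≡n i<j) (lhsTerm-reindex m i (j ℕ.∸ suc i))

proposition3 : (n j : ℕ) → 1 ≤ j → j ≤ n → lhs n j ≡ rhs n j
proposition3 n j _ j≤n = subst (λ n → lhs n j ≡ rhs n j) (ℕ.m∸n+n≡m j≤n) (begin
  lhs (m ℕ.+ j) j                      ≡⟨ lhs≡binomialSum m j ⟩
  binomialSum m 3 (m ℕ.+ j) j          ≡⟨ binomialSum≡h m 2 j ⟩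
  h (λ i → 1/suc (m ℕ.+ i)) 3 j        ≡⟨ rhs≡h₃ m j ⟨
  rhs (m ℕ.+ j) j                      ∎)
  where
  open ≡-Reasoning
  m = n ℕ.∸ j
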